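{- Let $\mathcal{M}_{\mathrm{AK}}=(W_A,W_K,(R_y)_{y\in W_K},(S_x)_{x\in W_A},V)$ be an AK model and let $\mathcal{M}^\beta_{\mathrm{EL}}=(W_K,(S^\beta_i)_{i\in\mathbf{A}},V^\beta)$ be the EL model with $yS^\beta_iz$ iff $yS_{T(i)^V}z$ (where $T(i)^V$ is the unique element of $V(T(i))$), and $V^\beta(p)=V(T(p))$ for $p\in\mathbf{Prop}$. Then for every epistemic formula $\varphi$, every $x\in W_A$ and every $y\in W_K$, \[ \mathcal{M}_{\mathrm{AK}},(x,y)\models T(\varphi)\iff \mathcal{M}^\beta_{\mathrm{EL}},y\models\varphi. \]
   Context: Epistemic logic: disjoint sets $\mathbf{Prop}$ and $\mathbf{A}$; formulas $\varphi::=p\mid\neg\varphi\mid\varphi\wedge\varphi\mid K_i\varphi$. An EL model $(W,(R_i)_{i\in\mathbf{A}},V)$ has $W$ nonempty, $R_i\subseteq W\times W$, $V:\mathbf{Prop}\to\mathcal{P}(W)$; $w\models p$ iff $w\in V(p)$, Boolean clauses usual, $w\models K_i\varphi$ iff $v\models\varphi$ for all $v$ with $wR_iv$. Agent-knowledge logic: pairwise disjoint sets $\mathbf{Prop}_A,\mathbf{Prop}_K,\mathbf{Nom}_A,\mathbf{Nom}_K$; formulas $\varphi ::= p_A\mid p_K\mid a\mid k\mid \neg\varphi\mid \varphi\wedge\varphi\mid \Box_A\varphi\mid\Box_K\varphi\mid @_a\varphi\mid @_k\varphi$. An AK model $(W_A,W_K,(R_y)_{y\in W_K},(S_x)_{x\in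 W_A},V)$: $W_A,W_K$ nonempty, $R_y\subseteq W_A^2$, $S_x\subseteq W_K^2$, $V$ maps $\mathbf{Prop}_A\cup\mathbf{Nom}_A$ to subsets of $W_A$ and $\mathbf{Prop}_K\cup\mathbf{Nom}_K$ to subsets of $W_K$, each nominal to a singleton ($V(a)=\{a^V\}$, $V(k)=\{k^V\}$). Satisfaction at $(x,y)$: $p_A$ iff $x\in V(p_A)$; $p_K$ iff $y\in V(p_K)$; $a$ iff $x=a^V$; $k$ iff $y=k^V$; Boolean as usual; $\Box_A\varphi$ iff $\varphi$ at all $(x',y)$ with $xR_yx'$; $\Box_K\varphi$ iff $\varphi$ at all $(x,y')$ with $yS_xy'$; $@_a\varphi$ iff $\varphi$ at $(a^V,y)$; $@_k\varphi$ iff $\varphi$ at $(x,k^V)$. Translation $T$: bijections $T:\mathbf{Prop}\to\mathbf{Prop}_K$, $T:\mathbf{A}\to\mathbf{Nom}_A$, extended by $T(\neg\varphi)=\neg T(\varphi)$, $T(\varphi\wedge\psi)=T(\varphi)\wedge T(\psi)$, $T(K_i\varphi)=@_{T(i)}\Box_KT(\varphi)$. -}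

module Defs where

open import Data.Product using (_×_; _,_)
open import Relation.Nullary using (¬_)
open import Relation.Binary.PropositionalEquality using (_≡_)
open import Function.Bundles using (_⤖_; Bijection)

open import Level using (0ℓ)

data ELForm (Prop Ag : Set) : Set where
  atom : Prop → ELForm Prop Ag
  ¬'_  : ELForm Prop Ag → ELForm Prop Ag
  _∧'_ : ELForm Prop Ag → ELForm Prop Ag → ELForm Prop Ag
  K    : Ag → ELForm Prop Ag → ELForm Prop Ag

record ELModel (Prop Ag : Set) : Set₁ where
  field
    W    : Set
    w₀   : W
    R    : Ag → W → W → Set
    V    : Prop → W → Set

module _ {Prop Ag : Set} (M : ELModel Prop Ag) where
  open ELModel M
  _⊨EL_ : W → ELForm Prop Ag → Set
  w ⊨EL atom p   = V p w
  w ⊨EL (¬' φ)   = ¬ (w ⊨EL φ)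
  w ⊨EL (φ ∧' ψ) = (w ⊨EL φ) × (w ⊨EL ψ)
  w ⊨EL K i φ    = ∀ v → R i w v → v ⊨EL φ

data AKForm (PropA PropK NomA NomK : Set) : Set where
  pA   : PropA → AKForm PropA PropK NomA NomK
  pK   : PropK → AKForm PropA PropK NomA NomK
  nA   : NomA → AKForm PropA PropK NomA NomK
  nK   : NomK → AKForm PropA PropK NomA NomK
  ¬'_  : AKForm PropA PropK NomA NomK → AKForm PropA PropK NomA NomK
  _∧'_ : AKForm PropA PropK NomA NomK → AKForm PropA PropK NomA NomK
       → AKForm PropA PropK NomA NomK
  □A   : AKForm PropA PropK NomA NomK → AKForm PropA PropK NomA NomK
  □K   : AKForm PropA PropK NomA NomK → AKForm PropA PropK NomA NomK
  atA   : NomA → AKForm PropA PropK NomA NomK → AKForm PropA PropK NomA NomK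
  atK   : NomK → AKForm PropA PropK NomA NomK → AKForm PropA PropK NomA NomK

-- The valuation of a nominal is a singleton {a^V}; we store the unique
-- element a^V directly, and V(a) is then the set {x ∣ x ≡ a^V}.
record AKModel (PropA PropK NomA NomK : Set) : Set₁ where
  field
    WA  : Set
    WK  : Set
    xA₀ : WA
    yK₀ : WK
    R   : WK → WA → WA → Set
    S   : WA → WK → WK → Set
    VA  : PropA → WA → Set
    VK  : PropK → WK → Set
    nomA : NomA → WA
    nomK : NomK → WK

module _ {PropA PropK NomA NomK : Set} (M : AKModel PropA PropK NomA NomK) where
  open AKModel M
  _,_⊨AK_ : WA → WK → AKForm PropA PropK NomA NomK → Set
  x , y ⊨AK pA p     = VA p x
  x , y ⊨AK pK p     = VK p y
  x , y ⊨AK nA a     = x ≡ nomA a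
  x , y ⊨AK nK k     = y ≡ nomK k
  x , y ⊨AK (¬' φ)   = ¬ (x , y ⊨AK φ)
  x , y ⊨AK (φ ∧' ψ) = (x , y ⊨AK φ) × (x , y ⊨AK ψ)
  x , y ⊨AK □A φ     = ∀ x' → R y x x' → x' , y ⊨AK φ
  x , y ⊨AK □K φ     = ∀ y' → S x y y' → x , y' ⊨AK φ
  x , y ⊨AK atA a φ   = nomA a , y ⊨AK φ
  x , y ⊨AK atK k φ   = x , nomK k ⊨AK φ

module _ {Prop Ag PropA PropK NomA NomK : Set}
         (TP : Prop ⤖ PropK) (TA : Ag ⤖ NomA) where
  open Bijection
  T : ELForm Prop Ag → AKForm PropA PropK NomA NomK
  T (atom p)  = pK (to TP p)
  T (¬' φ)    = ¬' T φ
  T (φ ∧' ψ)  = T φ ∧' T ψ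
  T (K i φ)   = atA (to TA i) (□K (T φ))

  βModel : AKModel PropA PropK NomA NomK → ELModel Prop Ag
  βModel M = record
    { W  = WK
    ; w₀ = yK₀
    ; R  = λ i y z → S (nomA (to TA i)) y z
    ; V  = λ p → VK (to TP p)
    }
    where open AKModel M

{-# OPTIONS --safe #-}
module Submission where

open import Defs
open import Function.Bundles using (_⤖_; _⇔_; mk⇔; Equivalence)
open import Function.Construct.Identity using (⇔-id)
open import Function.Related.TypeIsomorphisms using (¬-cong-⇔)
open import Data.Product.Function.NonDependent.Propositional using (_×-⇔_)

-- Translated formulas never look at the W_A coordinate except through
-- nominals, so the truth lemma holds uniformly in x; the K case moves x to
-- the agent's nominal, which is why x must stay general in the induction.

∀-guarded-cong-⇔ : {W : Set} {G P Q : W → Set}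
                 → (∀ v → P v ⇔ Q v)
                 → (∀ v → G v → P v) ⇔ (∀ v → G v → Q v)
∀-guarded-cong-⇔ P⇔Q = mk⇔
  (λ f v g → Equivalence.to (P⇔Q v) (f v g))
  (λ f v g → Equivalence.from (P⇔Q v) (f v g))

module _ {Prop Ag PropA PropK NomA NomK : Set}
         (TP : Prop ⤖ PropK) (TA : Ag ⤖ NomA)
         (M : AKModel PropA PropK NomA NomK) where
  open AKModel M

  T-truth : (φ : ELForm Prop Ag) (x : WA) (y : WK)
          → _,_⊨AK_ M x y (T TP TA φ) ⇔ _⊨EL_ (βModel TP TA M) y φ
  T-truth (atom p)  x y = ⇔-id _
  T-truth (¬' φ)    x y = ¬-cong-⇔ (T-truth φ x y)
  T-truth (φ ∧' ψ)  x y = T-truth φ x y ×-⇔ T-truth ψ x y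
  T-truth (K i φ)   x y = ∀-guarded-cong-⇔ (T-truth φ _)

mainTheorem3 : {Prop Ag PropA PropK NomA NomK : Set}
    → (TP : Prop ⤖ PropK) (TA : Ag ⤖ NomA)
    → (M : AKModel PropA PropK NomA NomK)
    → (φ : ELForm Prop Ag)
    → (x : AKModel.WA M) (y : AKModel.WK M)
    → (_,_⊨AK_ M x y (T TP TA φ)) ⇔ (_⊨EL_ (βModel TP TA M) y φ)
mainTheorem3 = T-truth
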